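{- (Trisection lemma.) Let $\mathfrak{m}$ be a rooted unicellular map of genus $g$. Then $\mathfrak{m}$ has exactly $2g$ trisections.
   Context: A unicellular map with $n$ edges is a triple $\mathfrak{m}=(H,\alpha,\sigma)$ where $H$ is a set of $2n$ elements (half-edges), $\alpha$ is a fixed-point-free involution of $H$, and $\sigma$ is a permutation of $H$ such that $\gamma=\alpha\sigma$ (i.e. $\gamma(h)=\alpha(\sigma(h))$) consists of a single cycle; the cycles of $\sigma$ are the vertices. A rooted map carries a distinguished half-edge $r$. The genus $g$ is defined by $v=n+1-2g$, where $v$ is the number of vertices. The total order $<_{\mathfrak{m}}$ on $H$ is $r<_{\mathfrak{m}}\gamma(r)<_{\mathfrak{m}}\dots<_{\mathfrak{m}}\gamma^{2n-1}(r)$. For $h\in H$, $V(h)$ denotes the vertex (cycle of $\sigma$) containing $h$, and $\min_{\mathfrak{m}}V(h)$ its minimal half-edge for $<_{\mathfrak{m}}$. A half-edge $h$ is a down-step if $\sigma(h)\le_{\mathfrak{m}}h$; a trisection is a down-step $h$ such that $\sigma(h)\neq\min_{\mathfrak{m}}V(h)$. -}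

module Defs where

open import Data.Nat using (ℕ; zero; suc; _+_; _*_; _≤_; _<_; _<ᵇ_)
open import Data.Nat.Properties using (_≤?_)
open import Data.Fin using (Fin; toℕ)
open import Data.Fin.Properties using (_≟_)
open import Data.Fin.Permutation using (Permutation′; _⟨$⟩ʳ_)
open import Data.List using (List; []; _∷_; length; filter; upTo; map; foldr)
open import Data.List using () renaming (allFin to allFinL)
open import Data.List.Relation.Unary.All using (All; all?)
open import Data.Product using (Σ; ∃; _×_; _,_)
open import Data.Bool using (if_then_else_)
open import Relation.Nullary using (¬_; ¬?)
open import Relation.Binary.PropositionalEquality using (_≡_; _≢_)

iter : {A : Set} → (A → A) → ℕ → A → A
iter f zero    x = x
iter f (suc k) x = f (iter f k x)

-- A rooted unicellular map with n edges: half-edges H = Fin (2 * n).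
record RootedUnicellularMap (n : ℕ) : Set where
  field
    α : Permutation′ (2 * n)
    σ : Permutation′ (2 * n)
    r : Fin (2 * n)
    α-involution : ∀ h → α ⟨$⟩ʳ (α ⟨$⟩ʳ h) ≡ h
    α-fixpoint-free : ∀ h → α ⟨$⟩ʳ h ≢ h
    -- γ = α σ consists of a single cycle: every half-edge lies in the γ-orbit of r
    γ-one-cycle : ∀ h → ∃ λ k → iter (λ x → α ⟨$⟩ʳ (σ ⟨$⟩ʳ x)) k r ≡ h

module _ {n : ℕ} (m : RootedUnicellularMap n) where
  open RootedUnicellularMap m

  N : ℕ
  N = 2 * n

  γ : Fin N → Fin N
  γ x = α ⟨$⟩ʳ (σ ⟨$⟩ʳ x)

  σf : Fin N → Fin N
  σf x = σ ⟨$⟩ʳ x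

  -- position of h in the order r < γ(r) < ... < γ^{2n-1}(r):
  -- the least k < 2n with γ^k(r) = h
  posFrom : ℕ → ℕ → Fin N → ℕ
  posFrom k zero      h = k
  posFrom k (suc fuel) h with iter γ k r ≟ h
  ... | Relation.Nullary.yes _ = k
  ... | Relation.Nullary.no  _ = posFrom (suc k) fuel h

  pos : Fin N → ℕ
  pos h = posFrom 0 N h

  _≤m_ : Fin N → Fin N → Set
  h ≤m h' = pos h ≤ pos h'

  vertexList : Fin N → List (Fin N)
  vertexList h = map (λ k → iter σf k h) (upTo N)

  minV : Fin N → Fin N
  minV h = foldr (λ x y → if pos x <ᵇ pos y then x else y) h (vertexList h)

  -- number of vertices = number of cycles of σ, counted by their
  -- representative (the Fin-least element of each cycle)
  isCycleRep : Fin N → Set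
  isCycleRep h = All (λ y → toℕ h ≤ toℕ y) (vertexList h)

  numVertices : ℕ
  numVertices = length (filter (λ h → all? (λ y → toℕ h ≤? toℕ y) (vertexList h)) (allFinL N))

  IsDownStep : Fin N → Set
  IsDownStep h = σf h ≤m h

  IsTrisection : Fin N → Set
  IsTrisection h = IsDownStep h × σf h ≢ minV h

  isTrisection? : ∀ h → Relation.Nullary.Dec (IsTrisection h)
  isTrisection? h with pos (σf h) ≤? pos h | σf h ≟ minV h
  ... | Relation.Nullary.yes p | Relation.Nullary.no q = Relation.Nullary.yes (p , q)
  ... | Relation.Nullary.no p  | _ = Relation.Nullary.no (λ { (a , _) → p a })
  ... | Relation.Nullary.yes _ | Relation.Nullary.yes q = Relation.Nullary.no (λ { (_ , b) → b q })

  numTrisections : ℕ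
  numTrisections = length (filter isTrisection? (allFinL N))

module Submission where

-- Proof by double counting of down-steps (h with σ h ≤ h in the tour order).
-- * Writing σ h = α (γ h), h is a down-step iff γ h is the root r or γ h is the
--   later of the two half-edges of its edge.  Transporting along the bijection γ,
--   and since each of the n edges has exactly one later end, there are n + 1
--   down-steps (module Tour).
-- * A down-step is either a trisection or satisfies σ h = min V(h); conversely
--   every h with σ h = min V(h) is a down-step, and σ maps these h bijectively
--   onto the vertex minima, so there are v of them (module Vertices).
-- Hence #trisections + v = n + 1 = v + 2g.

open import Defs
open import Data.Nat using (ℕ; zero; suc; _+_; _*_; _∸_; _≤_; _<_; z≤n; s≤s; _%_; _/_; _<ᵇ_; _≤?_; _<?_)
open import Data.Nat.Properties hiding (_≤?_; _<?_; _≟_)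
open import Data.Nat.Properties using () renaming (_≟_ to _≟ℕ_)
open import Data.Nat.DivMod using (m≡m%n+[m/n]*n; m%n<n)
open import Data.Fin using (Fin; toℕ; fromℕ<)
open import Data.Fin.Properties using (_≟_; pigeonhole; toℕ<n; toℕ-fromℕ<; toℕ-injective; injective⇒≤)
open import Data.Fin.Permutation using (Permutation′; _⟨$⟩ʳ_; _⟨$⟩ˡ_; inverseˡ; inverseʳ; _∘ₚ_)
open import Data.List using (List; []; _∷_; _++_; length; filter; map; foldr; allFin)
open import Data.List.Properties using (length-map; length-++-sucʳ; filter-none; filter-≐; length-tabulate)
open import Data.List.Membership.Propositional using (_∈_)
open import Data.List.Membership.Propositional.Properties using (∈-∃++; ∈-map⁺; ∈-map⁻; ∈-upTo⁺; ∈-filter⁺; ∈-filter⁻; ∈-allFin)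
open import Data.List.Relation.Unary.Any using (here; there)
open import Data.List.Relation.Unary.All as All using (All; []; _∷_)
open import Data.List.Relation.Unary.All.Properties using (map⁺)
open import Data.List.Relation.Unary.AllPairs using ([]; _∷_)
open import Data.List.Relation.Unary.Unique.Propositional using (Unique)
open import Data.List.Relation.Unary.Unique.Propositional.Properties using (filter⁺; allFin⁺)
open import Data.Bool using (true; false; if_then_else_; T)
open import Data.Unit using (tt)
open import Data.Product using (∃; _×_; _,_; proj₁; proj₂)
open import Data.Sum using (_⊎_; inj₁; inj₂)
open import Data.Empty using (⊥-elim)
open import Level using (0ℓ)
open import Relation.Nullary using (¬_; Dec; yes; no; ¬?; _×-dec_; _⊎-dec_)
open import Relation.Unary using (Pred; Decidable; _≐_)
open import Relation.Binary.PropositionalEquality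

module ListLemmas {A : Set} where

  ∈-delete : ∀ {x y : A} us {vs} → y ∈ us ++ x ∷ vs → y ≢ x → y ∈ us ++ vs
  ∈-delete []       (here y≡x)  y≢x = ⊥-elim (y≢x y≡x)
  ∈-delete []       (there y∈)  _   = y∈
  ∈-delete (u ∷ us) (here y≡u)  _   = here y≡u
  ∈-delete (u ∷ us) (there y∈)  y≢x = there (∈-delete us y∈ y≢x)

  length-≤-⊆ : ∀ (xs ys : List A) → Unique xs → (∀ {x} → x ∈ xs → x ∈ ys) →
               length xs ≤ length ys
  length-≤-⊆ []       ys _           _   = z≤n
  length-≤-⊆ (x ∷ xs) ys (x∉xs ∷ xs!) xs⊆ys with ∈-∃++ (xs⊆ys (here refl))
  ... | us , vs , refl =
    subst (suc (length xs) ≤_) (sym (length-++-sucʳ us x vs))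
      (s≤s (length-≤-⊆ xs (us ++ vs) xs! λ y∈xs →
        ∈-delete us (xs⊆ys (there y∈xs)) (λ y≡x → All.lookup x∉xs y∈xs (sym y≡x))))

  unique-map : ∀ {B : Set} (f : A → B) (xs : List A) → Unique xs →
               (∀ {a b} → a ∈ xs → b ∈ xs → f a ≡ f b → a ≡ b) → Unique (map f xs)
  unique-map f []       _            _   = []
  unique-map f (x ∷ xs) (x∉xs ∷ xs!) inj =
    map⁺ (All.tabulate λ y∈xs fx≡fy → All.lookup x∉xs y∈xs (inj (here refl) (there y∈xs) fx≡fy))
    ∷ unique-map f xs xs! (λ a∈ b∈ → inj (there a∈) (there b∈))

  length-filter-split : ∀ {P R : Pred A 0ℓ} (P? : Decidable P) (R? : Decidable R) xs →
    length (filter P? xs) ≡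
    length (filter (λ x → P? x ×-dec R? x) xs) + length (filter (λ x → P? x ×-dec ¬? (R? x)) xs)
  length-filter-split P? R? [] = refl
  length-filter-split P? R? (x ∷ xs) with P? x | R? x
  ... | yes _ | yes _ = cong suc (length-filter-split P? R? xs)
  ... | yes _ | no _  = trans (cong suc (length-filter-split P? R? xs)) (sym (+-suc _ _))
  ... | no _  | _     = length-filter-split P? R? xs

  length-filter-complement : ∀ {P : Pred A 0ℓ} (P? : Decidable P) xs →
    length (filter P? xs) + length (filter (λ x → ¬? (P? x)) xs) ≡ length xs
  length-filter-complement P? [] = refl
  length-filter-complement P? (x ∷ xs) with P? x
  ... | yes _ = cong suc (length-filter-complement P? xs)
  ... | no _  = trans (+-suc _ _) (cong suc (length-filter-complement P? xs))

  length-filter-single : ∀ (r : A) (_≟r : ∀ x → Dec (x ≡ r)) xs →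
    Unique xs → r ∈ xs → length (filter _≟r xs) ≡ 1
  length-filter-single r _≟r (x ∷ xs) (x∉xs ∷ _) (here refl) with x ≟r
  ... | yes _   = cong suc (cong length (filter-none _≟r (All.map (λ x≢y y≡x → x≢y (sym y≡x)) x∉xs)))
  ... | no x≢x  = ⊥-elim (x≢x refl)
  length-filter-single r _≟r (x ∷ xs) (x∉xs ∷ xs!) (there r∈xs) with x ≟r
  ... | yes refl = ⊥-elim (All.lookup x∉xs r∈xs refl)
  ... | no _     = length-filter-single r _≟r xs xs! r∈xs

open ListLemmas

module Counting {N : ℕ} where

  count : {P : Pred (Fin N) 0ℓ} → Decidable P → ℕ
  count P? = length (filter P? (allFin N))

  count-≤ : ∀ {P Q : Pred (Fin N) 0ℓ} (P? : Decidable P) (Q? : Decidable Q) (f : Fin N → Fin N) →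
    (∀ x → P x → Q (f x)) → (∀ x y → P x → P y → f x ≡ f y → x ≡ y) → count P? ≤ count Q?
  count-≤ {P} P? Q? f P⇒Qf injP =
    ≤-trans (≤-reflexive (sym (length-map f Ps)))
      (length-≤-⊆ (map f Ps) (filter Q? (allFin N))
        (unique-map f Ps (filter⁺ P? (allFin⁺ N)) λ a∈ b∈ → injP _ _ (P-of a∈) (P-of b∈))
        image⊆Q)
    where
    Ps : List (Fin N)
    Ps = filter P? (allFin N)
    P-of : ∀ {x} → x ∈ Ps → P x
    P-of x∈ = proj₂ (∈-filter⁻ P? {xs = allFin N} x∈)
    image⊆Q : ∀ {y} → y ∈ map f Ps → y ∈ filter Q? (allFin N)
    image⊆Q y∈ with ∈-map⁻ f y∈
    ... | x , x∈ , refl = ∈-filter⁺ Q? (∈-allFin (f x)) (P⇒Qf x (P-of x∈))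

  ⟨$⟩ʳ-injective : ∀ (π : Permutation′ N) {a b} → π ⟨$⟩ʳ a ≡ π ⟨$⟩ʳ b → a ≡ b
  ⟨$⟩ʳ-injective π e = trans (sym (inverseˡ π)) (trans (cong (π ⟨$⟩ˡ_) e) (inverseˡ π))

  ⟨$⟩ˡ-injective : ∀ (π : Permutation′ N) {a b} → π ⟨$⟩ˡ a ≡ π ⟨$⟩ˡ b → a ≡ b
  ⟨$⟩ˡ-injective π e = trans (sym (inverseʳ π)) (trans (cong (π ⟨$⟩ʳ_) e) (inverseʳ π))

  count-perm : ∀ {P Q : Pred (Fin N) 0ℓ} (P? : Decidable P) (Q? : Decidable Q) (π : Permutation′ N) →
    (∀ x → P x → Q (π ⟨$⟩ʳ x)) → (∀ y → Q y → P (π ⟨$⟩ˡ y)) → count P? ≡ count Q?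
  count-perm P? Q? π P⇒Q Q⇒P = ≤-antisym
    (count-≤ P? Q? (π ⟨$⟩ʳ_) P⇒Q λ _ _ _ _ → ⟨$⟩ʳ-injective π)
    (count-≤ Q? P? (π ⟨$⟩ˡ_) Q⇒P λ _ _ _ _ → ⟨$⟩ˡ-injective π)

  count-≐ : ∀ {P Q : Pred (Fin N) 0ℓ} (P? : Decidable P) (Q? : Decidable Q) → P ≐ Q → count P? ≡ count Q?
  count-≐ P? Q? P≐Q = cong length (filter-≐ P? Q? P≐Q (allFin N))

  count-split : ∀ {P R : Pred (Fin N) 0ℓ} (P? : Decidable P) (R? : Decidable R) →
    count P? ≡ count (λ x → P? x ×-dec R? x) + count (λ x → P? x ×-dec ¬? (R? x))
  count-split P? R? = length-filter-split P? R? (allFin N)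

  count-complement : ∀ {P : Pred (Fin N) 0ℓ} (P? : Decidable P) → count P? + count (λ x → ¬? (P? x)) ≡ N
  count-complement P? = trans (length-filter-complement P? (allFin N)) (length-tabulate (λ x → x))

  count-single : ∀ (r : Fin N) → count (_≟ r) ≡ 1
  count-single r = length-filter-single r (_≟ r) (allFin N) (allFin⁺ N) (∈-allFin r)

  count-insert : ∀ {P : Pred (Fin N) 0ℓ} (P? : Decidable P) (r : Fin N) → ¬ P r →
    count (λ x → (x ≟ r) ⊎-dec P? x) ≡ suc (count P?)
  count-insert P? r ¬Pr = trans (count-split (λ x → (x ≟ r) ⊎-dec P? x) (_≟ r))
    (cong₂ _+_ (trans (count-≐ _ (_≟ r) (proj₂ , λ x≡r → inj₁ x≡r , x≡r)) (count-single r))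
               (count-≐ _ P? ((λ { (inj₁ x≡r , x≢r) → ⊥-elim (x≢r x≡r) ; (inj₂ Px , _) → Px })
                             , λ {x} Px → inj₂ Px , λ { refl → ¬Pr Px })))

  count-swap : ∀ {P : Pred (Fin N) 0ℓ} (P? : Decidable P) (π : Permutation′ N) →
    (∀ x → ¬ P x → P (π ⟨$⟩ʳ x)) → (∀ x → P (π ⟨$⟩ʳ x) → ¬ P x) → count P? + count P? ≡ N
  count-swap {P} P? π ¬P⇒Pπ Pπ⇒¬P = trans (cong (count P? +_) (sym ¬P≡P)) (count-complement P?)
    where
    ¬P≡P : count (λ x → ¬? (P? x)) ≡ count P?
    ¬P≡P = count-perm _ P? π ¬P⇒Pπ λ y Py → Pπ⇒¬P (π ⟨$⟩ˡ y) (subst P (sym (inverseʳ π)) Py)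

  record Selector (_~_ : Fin N → Fin N → Set) : Set where
    field
      select           : Fin N → Fin N
      select-related   : ∀ x → x ~ select x
      select-invariant : ∀ x y → x ~ y → select y ≡ select x

  open Selector public

  fixed? : (S : Fin N → Fin N) → Decidable (λ x → S x ≡ x)
  fixed? S x = S x ≟ x

  -- the representatives chosen by S are mapped injectively by S′ to those chosen by S′
  count-fixed-≤ : ∀ {_~_} (S S′ : Selector _~_) → count (fixed? (select S)) ≤ count (fixed? (select S′))
  count-fixed-≤ S S′ = count-≤ (fixed? (select S)) (fixed? (select S′)) (select S′)
    (λ x _ → S′-invariant x)
    (λ x y Sx≡x Sy≡y S′x≡S′y → begin
      x                      ≡⟨ sym Sx≡x ⟩
      select S x             ≡⟨ sym (S-after-S′ x) ⟩
      select S (select S′ x) ≡⟨ cong (select S) S′x≡S′y ⟩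
      select S (select S′ y) ≡⟨ S-after-S′ y ⟩
      select S y             ≡⟨ Sy≡y ⟩
      y                      ∎)
    where
    open ≡-Reasoning
    S′-invariant : ∀ x → select S′ (select S′ x) ≡ select S′ x
    S′-invariant x = select-invariant S′ x (select S′ x) (select-related S′ x)
    S-after-S′ : ∀ x → select S (select S′ x) ≡ select S x
    S-after-S′ x = select-invariant S x (select S′ x) (select-related S′ x)

  count-fixed : ∀ {_~_} (S S′ : Selector _~_) → count (fixed? (select S)) ≡ count (fixed? (select S′))
  count-fixed S S′ = ≤-antisym (count-fixed-≤ S S′) (count-fixed-≤ S′ S)

module Iteration {N : ℕ} (f : Fin N → Fin N) (f-injective : ∀ {a b} → f a ≡ f b → a ≡ b) where

  iter-+ : ∀ a b x → iter f (a + b) x ≡ iter f a (iter f b x)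
  iter-+ zero    b x = refl
  iter-+ (suc a) b x = cong f (iter-+ a b x)

  iter-injective : ∀ k {a b} → iter f k a ≡ iter f k b → a ≡ b
  iter-injective zero    e = e
  iter-injective (suc k) e = iter-injective k (f-injective e)

  return-time : ∀ x i j → i < j → iter f i x ≡ iter f j x → ∃ λ p → suc p ≤ j × iter f (suc p) x ≡ x
  return-time x i j i<j fⁱx≡fʲx with m≤n⇒∃[o]m+o≡n i<j
  ... | p , 1+i+p≡j = p , subst (suc p ≤_) 1+i+p≡j (s≤s (m≤n+m p i)) ,
    sym (iter-injective i (begin
      iter f i x                 ≡⟨ fⁱx≡fʲx ⟩
      iter f j x                 ≡⟨ cong (λ k → iter f k x) (trans (sym 1+i+p≡j) (sym (+-suc i p))) ⟩
      iter f (i + suc p) x       ≡⟨ iter-+ i (suc p) x ⟩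
      iter f i (iter f (suc p) x) ∎))
    where open ≡-Reasoning

  -- every point returns to itself after at most N steps (pigeonhole on x, f x, …, f^N x)
  period : ∀ x → ∃ λ p → suc p ≤ N × iter f (suc p) x ≡ x
  period x with pigeonhole (n<1+n N) (λ i → iter f (toℕ i) x)
  ... | i , j , i<j , eq with return-time x (toℕ i) (toℕ j) i<j eq
  ...   | p , p<j , fᵖx≡x = p , ≤-trans p<j (≤-pred (toℕ<n j)) , fᵖx≡x

  module _ (x : Fin N) (p : ℕ) (fᵖx≡x : iter f (suc p) x ≡ x) where
    iter-multiple : ∀ q → iter f (q * suc p) x ≡ x
    iter-multiple zero    = refl
    iter-multiple (suc q) = trans (iter-+ (suc p) (q * suc p) x)
                                  (trans (cong (iter f (suc p)) (iter-multiple q)) fᵖx≡x)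

    iter-mod : ∀ k → iter f k x ≡ iter f (k % suc p) x
    iter-mod k = trans (cong (λ j → iter f j x) (m≡m%n+[m/n]*n k (suc p)))
      (trans (iter-+ (k % suc p) ((k / suc p) * suc p) x)
             (cong (iter f (k % suc p)) (iter-multiple (k / suc p))))

  iter-bounded : ∀ x k → ∃ λ k′ → k′ < N × iter f k′ x ≡ iter f k x
  iter-bounded x k with period x
  ... | p , p<N , fᵖx≡x = k % suc p , ≤-trans (m%n<n k (suc p)) p<N , sym (iter-mod x p fᵖx≡x k)

  iter-return : ∀ x k → ∃ λ k′ → iter f k′ (iter f k x) ≡ x
  iter-return x k with period x
  ... | p , _ , fᵖx≡x = k * suc p ∸ k ,
    trans (sym (iter-+ (k * suc p ∸ k) k x))
      (trans (cong (λ j → iter f j x) (m∸n+n≡m (m≤m*n k (suc p)))) (iter-multiple x p fᵖx≡x k))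

  module FullOrbit (x : Fin N) (full : ∀ h → ∃ λ k → iter f k x ≡ h) where

    period-≥ : ∀ p → iter f (suc p) x ≡ x → N ≤ suc p
    period-≥ p fᵖx≡x = injective⇒≤ {f = exponent} exponent-injective
      where
      exponent : Fin N → Fin (suc p)
      exponent h = fromℕ< (m%n<n (proj₁ (full h)) (suc p))
      exponent-sound : ∀ h → iter f (toℕ (exponent h)) x ≡ h
      exponent-sound h = trans (cong (λ j → iter f j x) (toℕ-fromℕ< (m%n<n (proj₁ (full h)) (suc p))))
                               (trans (sym (iter-mod x p fᵖx≡x (proj₁ (full h)))) (proj₂ (full h)))
      exponent-injective : ∀ {a b} → exponent a ≡ exponent b → a ≡ b
      exponent-injective {a} {b} e =
        trans (sym (exponent-sound a)) (trans (cong (λ i → iter f (toℕ i) x) e) (exponent-sound b))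

    iter-N : iter f N x ≡ x
    iter-N with period x
    ... | p , p<N , fᵖx≡x = subst (λ k → iter f k x ≡ x) (≤-antisym p<N (period-≥ p fᵖx≡x)) fᵖx≡x

    iter-distinct : ∀ i j → i < j → j < N → iter f i x ≢ iter f j x
    iter-distinct i j i<j j<N eq with return-time x i j i<j eq
    ... | p , p<j , fᵖx≡x = <⇒≱ (≤-<-trans p<j j<N) (period-≥ p fᵖx≡x)

module ArgMin {A : Set} (κ : A → ℕ) where

  -- keep the earlier argument only if its key is strictly smaller, as in minV
  pick : A → A → A
  pick x y = if κ x <ᵇ κ y then x else y

  argmin : A → List A → A
  argmin d L = foldr pick d L

  pick-cases : ∀ x y → (pick x y ≡ x × κ x < κ y) ⊎ (pick x y ≡ y × κ y ≤ κ x)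
  pick-cases x y with κ x <ᵇ κ y in eq
  ... | true  = inj₁ (refl , <ᵇ⇒< (κ x) (κ y) (subst T (sym eq) tt))
  ... | false = inj₂ (refl , ≮⇒≥ (λ lt → subst T eq (<⇒<ᵇ lt)))

  argmin-∈ : ∀ d L → argmin d L ≡ d ⊎ argmin d L ∈ L
  argmin-∈ d [] = inj₁ refl
  argmin-∈ d (x ∷ L) with pick-cases x (argmin d L)
  ... | inj₁ (≡x , _) = inj₂ (here ≡x)
  ... | inj₂ (≡rest , _) with argmin-∈ d L
  ...   | inj₁ ≡d = inj₁ (trans ≡rest ≡d)
  ...   | inj₂ ∈L = inj₂ (there (subst (_∈ L) (sym ≡rest) ∈L))

  argmin-≤ : ∀ d L → κ (argmin d L) ≤ κ d × All (λ y → κ (argmin d L) ≤ κ y) L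
  argmin-≤ d [] = ≤-refl , []
  argmin-≤ d (x ∷ L) with argmin-≤ d L | pick-cases x (argmin d L)
  ... | (≤d , ≤L) | inj₁ (≡x , x<) rewrite ≡x =
        ≤-trans (<⇒≤ x<) ≤d , ≤-refl ∷ All.map (≤-trans (<⇒≤ x<)) ≤L
  ... | (≤d , ≤L) | inj₂ (≡rest , ≤x) rewrite ≡rest = ≤d , ≤x ∷ ≤L

module Tour {n : ℕ} (m : RootedUnicellularMap n) where
  open RootedUnicellularMap m
  open Counting {2 * n}

  γπ : Permutation′ (2 * n)
  γπ = σ ∘ₚ α

  γ-injective : ∀ {a b} → γ m a ≡ γ m b → a ≡ b
  γ-injective = ⟨$⟩ʳ-injective γπ

  open Iteration (γ m) γ-injective using (iter-bounded)
  open Iteration.FullOrbit (γ m) γ-injective r γ-one-cycle using (iter-N; iter-distinct)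

  posFrom-hit : ∀ fuel k h j → k ≤ j → j < fuel + k → iter (γ m) j r ≡ h →
                iter (γ m) (posFrom m k fuel h) r ≡ h × posFrom m k fuel h ≤ j
  posFrom-hit zero       k h j k≤j j<k _ = ⊥-elim (<⇒≱ j<k k≤j)
  posFrom-hit (suc fuel) k h j k≤j j<  γʲr≡h with iter (γ m) k r ≟ h
  ... | yes γᵏr≡h = γᵏr≡h , k≤j
  ... | no  γᵏr≢h with k ≟ℕ j
  ...   | yes refl = ⊥-elim (γᵏr≢h γʲr≡h)
  ...   | no  k≢j  = posFrom-hit fuel (suc k) h j (≤∧≢⇒< k≤j k≢j) (subst (j <_) (sym (+-suc fuel k)) j<) γʲr≡h

  pos-≤ : ∀ h j → j < 2 * n → iter (γ m) j r ≡ h → iter (γ m) (pos m h) r ≡ h × pos m h ≤ j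
  pos-≤ h j j<2n = posFrom-hit (2 * n) 0 h j z≤n (subst (j <_) (sym (+-identityʳ (2 * n))) j<2n)

  pos-spec : ∀ h → iter (γ m) (pos m h) r ≡ h × pos m h < 2 * n
  pos-spec h with γ-one-cycle h
  ... | k , γᵏr≡h with iter-bounded r k
  ...   | k′ , k′<2n , γᵏ′r≡γᵏr with pos-≤ h k′ k′<2n (trans γᵏ′r≡γᵏr γᵏr≡h)
  ...     | hit , pos≤k′ = hit , ≤-<-trans pos≤k′ k′<2n

  pos-iter : ∀ j → j < 2 * n → pos m (iter (γ m) j r) ≡ j
  pos-iter j j<2n with pos-≤ (iter (γ m) j r) j j<2n refl
  ... | hit , pos≤j with m≤n⇒m<n∨m≡n pos≤j
  ...   | inj₁ pos<j = ⊥-elim (iter-distinct _ j pos<j j<2n hit)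
  ...   | inj₂ pos≡j = pos≡j

  pos-injective : ∀ {a b} → pos m a ≡ pos m b → a ≡ b
  pos-injective {a} {b} e =
    trans (sym (proj₁ (pos-spec a))) (trans (cong (λ k → iter (γ m) k r) e) (proj₁ (pos-spec b)))

  pos-r : pos m r ≡ 0
  pos-r = pos-iter 0 (≤-<-trans z≤n (toℕ<n r))

  γ-after : ∀ h → γ m h ≡ iter (γ m) (suc (pos m h)) r
  γ-after h = cong (γ m) (sym (proj₁ (pos-spec h)))

  pos-γ : ∀ h → suc (pos m h) < 2 * n → pos m (γ m h) ≡ suc (pos m h)
  pos-γ h lt = trans (cong (pos m) (γ-after h)) (pos-iter (suc (pos m h)) lt)

  γ-last : ∀ h → suc (pos m h) ≡ 2 * n → γ m h ≡ r
  γ-last h last = trans (γ-after h) (trans (cong (λ k → iter (γ m) k r) last) iter-N)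

  LaterEnd : Fin (2 * n) → Set
  LaterEnd x = pos m (α ⟨$⟩ʳ x) < pos m x

  laterEnd? : ∀ x → Dec (LaterEnd x)
  laterEnd? x = pos m (α ⟨$⟩ʳ x) <? pos m x

  laterEnd-partner : ∀ x → ¬ LaterEnd x → LaterEnd (α ⟨$⟩ʳ x)
  laterEnd-partner x ¬later = subst (λ y → pos m y < pos m (α ⟨$⟩ʳ x)) (sym (α-involution x))
    (≤∧≢⇒< (≮⇒≥ ¬later) (λ e → α-fixpoint-free x (sym (pos-injective e))))

  laterEnd-unique : ∀ x → LaterEnd (α ⟨$⟩ʳ x) → ¬ LaterEnd x
  laterEnd-unique x laterα later =
    <-asym later (subst (λ y → pos m y < pos m (α ⟨$⟩ʳ x)) (α-involution x) laterα)

  -- each edge has exactly one later end, so there are n of them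
  count-laterEnd : count laterEnd? ≡ n
  count-laterEnd = *-cancelˡ-≡ (count laterEnd?) n 2 (begin
    2 * count laterEnd?               ≡⟨ cong (count laterEnd? +_) (+-identityʳ (count laterEnd?)) ⟩
    count laterEnd? + count laterEnd? ≡⟨ count-swap laterEnd? α laterEnd-partner laterEnd-unique ⟩
    2 * n                             ∎)
    where open ≡-Reasoning

  downStep? : ∀ h → Dec (IsDownStep m h)
  downStep? h = pos m (σf m h) ≤? pos m h

  -- σ = α γ since α is an involution
  σ≡αγ : ∀ h → σf m h ≡ α ⟨$⟩ʳ (γ m h)
  σ≡αγ h = sym (α-involution (σ ⟨$⟩ʳ h))

  -- h is a down-step iff γ h is the root or a later end: σ h = α (γ h) comes before γ h
  downStep⇒ : ∀ h → IsDownStep m h → γ m h ≡ r ⊎ LaterEnd (γ m h)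
  downStep⇒ h down with m≤n⇒m<n∨m≡n (proj₂ (pos-spec h))
  ... | inj₂ last = inj₁ (γ-last h last)
  ... | inj₁ lt   = inj₂ (subst (pos m (α ⟨$⟩ʳ γ m h) <_) (sym (pos-γ h lt))
                            (s≤s (subst (λ y → pos m y ≤ pos m h) (σ≡αγ h) down)))

  downStep⇐ : ∀ h → γ m h ≡ r ⊎ LaterEnd (γ m h) → IsDownStep m h
  downStep⇐ h _ with m≤n⇒m<n∨m≡n (proj₂ (pos-spec h))
  downStep⇐ h _              | inj₂ last = ≤-pred (subst (pos m (σf m h) <_) (sym last) (proj₂ (pos-spec (σf m h))))
  downStep⇐ h (inj₁ γh≡r)    | inj₁ lt   = ⊥-elim (0≢1+n (trans (sym pos-r) (trans (cong (pos m) (sym γh≡r)) (pos-γ h lt))))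
  downStep⇐ h (inj₂ laterγh) | inj₁ lt   =
    ≤-pred (subst (λ y → pos m y < suc (pos m h)) (sym (σ≡αγ h)) (subst (pos m (α ⟨$⟩ʳ γ m h) <_) (pos-γ h lt) laterγh))

  count-downSteps : count downStep? ≡ suc n
  count-downSteps = begin
    count downStep?                                  ≡⟨ count-perm downStep? rootOrLater? γπ downStep⇒
                                                          (λ y d → downStep⇐ (γπ ⟨$⟩ˡ y) (subst RootOrLater (sym (inverseʳ γπ)) d)) ⟩
    count rootOrLater?                               ≡⟨ count-insert laterEnd? r (λ later → n≮0 (subst (pos m (α ⟨$⟩ʳ r) <_) pos-r later)) ⟩
    suc (count laterEnd?)                            ≡⟨ cong suc count-laterEnd ⟩
    suc n                                            ∎
    where
    open ≡-Reasoning
    RootOrLater : Fin (2 * n) → Set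
    RootOrLater x = x ≡ r ⊎ LaterEnd x
    rootOrLater? : ∀ x → Dec (RootOrLater x)
    rootOrLater? x = (x ≟ r) ⊎-dec laterEnd? x

module Vertices {n : ℕ} (m : RootedUnicellularMap n) where
  open RootedUnicellularMap m
  open Counting {2 * n}
  open Tour m using (pos-injective; downStep?)
  open Iteration (σf m) (⟨$⟩ʳ-injective σ) using (iter-+; iter-bounded; iter-return)

  SameVertex : Fin (2 * n) → Fin (2 * n) → Set
  SameVertex x y = ∃ λ k → iter (σf m) k x ≡ y

  sameVertex-trans : ∀ {x y z} → SameVertex x y → SameVertex y z → SameVertex x z
  sameVertex-trans {x} (k , refl) (l , refl) = l + k , iter-+ l k x

  sameVertex-sym : ∀ {x y} → SameVertex x y → SameVertex y x
  sameVertex-sym {x} (k , refl) = iter-return x k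

  vertexList-complete : ∀ {x y} → SameVertex x y → y ∈ vertexList m x
  vertexList-complete {x} (k , refl) with iter-bounded x k
  ... | k′ , k′<2n , σᵏ′x≡σᵏx = subst (_∈ vertexList m x) σᵏ′x≡σᵏx (∈-map⁺ (λ j → iter (σf m) j x) (∈-upTo⁺ k′<2n))

  vertexList-sound : ∀ {x y} → y ∈ vertexList m x → SameVertex x y
  vertexList-sound {x} y∈ with ∈-map⁻ (λ j → iter (σf m) j x) y∈
  ... | k , _ , y≡σᵏx = k , sym y≡σᵏx

  module VertexMin (κ : Fin (2 * n) → ℕ) (κ-injective : ∀ {a b} → κ a ≡ κ b → a ≡ b) where
    open ArgMin κ

    vertexMin : Fin (2 * n) → Fin (2 * n)
    vertexMin h = argmin h (vertexList m h)

    vertexMin-related : ∀ h → SameVertex h (vertexMin h)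
    vertexMin-related h with argmin-∈ h (vertexList m h)
    ... | inj₁ ≡h = 0 , sym ≡h
    ... | inj₂ ∈V = vertexList-sound ∈V

    vertexMin-minimal : ∀ h y → SameVertex h y → κ (vertexMin h) ≤ κ y
    vertexMin-minimal h y h~y = All.lookup (proj₂ (argmin-≤ h (vertexList m h))) (vertexList-complete h~y)

    vertexMin-invariant : ∀ h y → SameVertex h y → vertexMin y ≡ vertexMin h
    vertexMin-invariant h y h~y = κ-injective (≤-antisym
      (vertexMin-minimal y (vertexMin h) (sameVertex-trans (sameVertex-sym h~y) (vertexMin-related h)))
      (vertexMin-minimal h (vertexMin y) (sameVertex-trans h~y (vertexMin-related y))))

    selector : Selector SameVertex
    selector = record { select = vertexMin ; select-related = vertexMin-related ; select-invariant = vertexMin-invariant }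

  -- minV is the selection by tour position; numVertices counts the selection by index
  module ByPosition = VertexMin (pos m) pos-injective
  module ByIndex    = VertexMin toℕ toℕ-injective

  numVertices-fixed : numVertices m ≡ count (fixed? ByIndex.vertexMin)
  numVertices-fixed = count-≐ (λ h → All.all? (λ y → toℕ h ≤? toℕ y) (vertexList m h)) (fixed? ByIndex.vertexMin)
    (isCycleRep⇒fixed , fixed⇒isCycleRep)
    where
    open ArgMin toℕ
    isCycleRep⇒fixed : ∀ {h} → isCycleRep m h → ByIndex.vertexMin h ≡ h
    isCycleRep⇒fixed {h} rep with argmin-∈ h (vertexList m h)
    ... | inj₁ ≡h = ≡h
    ... | inj₂ ∈V = toℕ-injective (≤-antisym (proj₁ (argmin-≤ h (vertexList m h))) (All.lookup rep ∈V))
    fixed⇒isCycleRep : ∀ {h} → ByIndex.vertexMin h ≡ h → isCycleRep m h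
    fixed⇒isCycleRep {h} fixed = subst (λ z → All (λ y → toℕ z ≤ toℕ y) (vertexList m h)) fixed
                                       (proj₂ (argmin-≤ h (vertexList m h)))

  -- h with σ h = min V(h); σ maps these bijectively onto the vertex minima
  SigmaToMin : Fin (2 * n) → Set
  SigmaToMin h = σf m h ≡ minV m h

  sigmaToMin? : ∀ h → Dec (SigmaToMin h)
  sigmaToMin? h = σf m h ≟ minV m h

  -- minV is, by definition, ByPosition.vertexMin, hence constant along σ
  minV-σ : ∀ h → minV m (σf m h) ≡ minV m h
  minV-σ h = ByPosition.vertexMin-invariant h (σf m h) (1 , refl)

  sigmaToMin⇒fixed : ∀ h → SigmaToMin h → ByPosition.vertexMin (σ ⟨$⟩ʳ h) ≡ σ ⟨$⟩ʳ h
  sigmaToMin⇒fixed h σh≡min = trans (minV-σ h) (sym σh≡min)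

  fixed⇒sigmaToMin : ∀ y → ByPosition.vertexMin y ≡ y → SigmaToMin (σ ⟨$⟩ˡ y)
  fixed⇒sigmaToMin y min≡y = begin
    σ ⟨$⟩ʳ (σ ⟨$⟩ˡ y)              ≡⟨ inverseʳ σ ⟩
    y                             ≡⟨ sym min≡y ⟩
    minV m y                      ≡⟨ cong (minV m) (sym (inverseʳ σ)) ⟩
    minV m (σ ⟨$⟩ʳ (σ ⟨$⟩ˡ y))      ≡⟨ minV-σ (σ ⟨$⟩ˡ y) ⟩
    minV m (σ ⟨$⟩ˡ y)              ∎
    where open ≡-Reasoning

  -- such an h is a down-step, as min V(h) precedes h
  sigmaToMin⇒downStep : ∀ h → SigmaToMin h → IsDownStep m h
  sigmaToMin⇒downStep h σh≡min =
    subst (λ y → pos m y ≤ pos m h) (sym σh≡min) (ByPosition.vertexMin-minimal h h (0 , refl))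

  count-sigmaToMin : count sigmaToMin? ≡ numVertices m
  count-sigmaToMin = begin
    count sigmaToMin?                       ≡⟨ count-perm sigmaToMin? (fixed? ByPosition.vertexMin) σ
                                                 sigmaToMin⇒fixed fixed⇒sigmaToMin ⟩
    count (fixed? ByPosition.vertexMin)     ≡⟨ count-fixed ByPosition.selector ByIndex.selector ⟩
    count (fixed? ByIndex.vertexMin)        ≡⟨ sym numVertices-fixed ⟩
    numVertices m                           ∎
    where open ≡-Reasoning

  count-downSteps-split : count downStep? ≡ numTrisections m + numVertices m
  count-downSteps-split = begin
    count downStep?                          ≡⟨ count-split downStep? sigmaToMin? ⟩
    count downToMin? + count downNotToMin?   ≡⟨ +-comm (count downToMin?) (count downNotToMin?) ⟩
    count downNotToMin? + count downToMin?   ≡⟨ cong₂ _+_ trisections minSteps ⟩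
    numTrisections m + numVertices m         ∎
    where
    open ≡-Reasoning
    downToMin? : Decidable (λ h → IsDownStep m h × SigmaToMin h)
    downNotToMin? : Decidable (λ h → IsDownStep m h × ¬ SigmaToMin h)
    downToMin? h    = downStep? h ×-dec sigmaToMin? h
    downNotToMin? h = downStep? h ×-dec ¬? (sigmaToMin? h)
    trisections : count downNotToMin? ≡ numTrisections m
    trisections = count-≐ downNotToMin? (isTrisection? m) ((λ t → t) , (λ t → t))
    minSteps : count downToMin? ≡ numVertices m
    minSteps = trans (count-≐ downToMin? sigmaToMin? (proj₂ , λ {h} σh≡min → sigmaToMin⇒downStep h σh≡min , σh≡min))
                     count-sigmaToMin

lemma3 : (n : ℕ) (m : RootedUnicellularMap n) (g : ℕ) →
         numVertices m + 2 * g ≡ n + 1 → numTrisections m ≡ 2 * g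
lemma3 n m g genus = +-cancelʳ-≡ (numVertices m) (numTrisections m) (2 * g) (begin
  numTrisections m + numVertices m     ≡⟨ sym (Vertices.count-downSteps-split m) ⟩
  Counting.count (Tour.downStep? m)    ≡⟨ Tour.count-downSteps m ⟩
  suc n                                ≡⟨ +-comm 1 n ⟩
  n + 1                                ≡⟨ sym genus ⟩
  numVertices m + 2 * g                ≡⟨ +-comm (numVertices m) (2 * g) ⟩
  2 * g + numVertices m                ∎)
  where open ≡-Reasoning
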